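{- If $A$ is infinite, then the axiomatization consisting of A1-4, WIF1, WIF2$'$ and W1 is $\omega$-complete for BCCS($A$).
   Context: $A$ is a nonempty countable set of actions, $\tau\notin A$, $A_\tau=A\cup\{\tau\}$. BCCS($A$) terms: $t::=0\mid x\mid\alpha t\mid t+t$ ($x$ from a countably infinite set of variables, $\alpha\in A_\tau$). Inequational logic: reflexivity, transitivity, substitution instances of axioms, closure under contexts; an equation abbreviates two inequations. $\omega$-complete: for all BCCS($A$) terms $t,u$, if $\rho(t)\preccurlyeq\rho(u)$ is derivable for every closed substitution $\rho$, then $t\preccurlyeq u$ is derivable. Axioms ($\alpha\in A_\tau$): A1: $x+y\approx y+x$; A2: $(x+y)+z\approx x+(y+z)$; A3: $x+x\approx x$; A4: $x+0\approx x$; WIF1: $\alpha(\tau x+\tau y)\approx\alpha x+\alpha y$; WIF2$'$: $\tau(x+y)\preccurlyeq\tau x+y$; W1: $x\preccurlyeq\tau x$. -}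

module Defs where

open import Data.Nat using (ℕ)
open import Function.Bundles using (_↣_)
open import Data.Product using (_×_)

data Act (A : Set) : Set where
  τ   : Act A
  act : A → Act A

data Term (A : Set) : Set where
  𝟎    : Term A
  var  : ℕ → Term A
  _·_  : Act A → Term A → Term A
  _⊕_  : Term A → Term A → Term A

infixr 7 _·_
infixl 6 _⊕_
infix 4 _⊢_≼_
infixl 8 _[_]

data Closed {A : Set} : Term A → Set where
  c𝟎 : Closed 𝟎
  c· : ∀ {α t} → Closed t → Closed (α · t)
  c⊕ : ∀ {t u} → Closed t → Closed u → Closed (t ⊕ u)

Subst : Set → Set
Subst A = ℕ → Term A

_[_] : {A : Set} → Term A → Subst A → Term A
𝟎 [ ρ ] = 𝟎
var x [ ρ ] = ρ x
(α · t) [ ρ ] = α · (t [ ρ ])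
(t ⊕ u) [ ρ ] = (t [ ρ ]) ⊕ (u [ ρ ])

ClosedSubst : {A : Set} → Subst A → Set
ClosedSubst ρ = ∀ x → Closed (ρ x)

-- Axiom rules are stated schematically for arbitrary
-- terms, which is exactly closure under substitution instances.
data _⊢_≼_ (A : Set) : Term A → Term A → Set where
  refl≼  : ∀ {t} → A ⊢ t ≼ t
  trans≼ : ∀ {t u v} → A ⊢ t ≼ u → A ⊢ u ≼ v → A ⊢ t ≼ v
  ctx·   : ∀ {α t u} → A ⊢ t ≼ u → A ⊢ α · t ≼ α · u
  ctx⊕   : ∀ {t t′ u u′} → A ⊢ t ≼ t′ → A ⊢ u ≼ u′ → A ⊢ t ⊕ u ≼ t′ ⊕ u′
  a1     : ∀ {x y} → A ⊢ x ⊕ y ≼ y ⊕ x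
  a2→    : ∀ {x y z} → A ⊢ (x ⊕ y) ⊕ z ≼ x ⊕ (y ⊕ z)
  a2←    : ∀ {x y z} → A ⊢ x ⊕ (y ⊕ z) ≼ (x ⊕ y) ⊕ z
  a3→    : ∀ {x} → A ⊢ x ⊕ x ≼ x
  a3←    : ∀ {x} → A ⊢ x ≼ x ⊕ x
  a4→    : ∀ {x} → A ⊢ x ⊕ 𝟎 ≼ x
  a4←    : ∀ {x} → A ⊢ x ≼ x ⊕ 𝟎
  wif1→  : ∀ {α x y} → A ⊢ α · (τ · x ⊕ τ · y) ≼ α · x ⊕ α · y
  wif1←  : ∀ {α x y} → A ⊢ α · x ⊕ α · y ≼ α · (τ · x ⊕ τ · y)
  wif2′  : ∀ {x y} → A ⊢ τ · (x ⊕ y) ≼ τ · x ⊕ y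
  w1     : ∀ {x} → A ⊢ x ≼ τ · x

OmegaComplete : Set → Set
OmegaComplete A =
  (t u : Term A) →
  ((ρ : Subst A) → ClosedSubst ρ → A ⊢ t [ ρ ] ≼ u [ ρ ]) →
  A ⊢ t ≼ u

-- A countable: injection into ℕ;  A infinite: injection from ℕ
-- (for a countable set, equivalent classically to being infinite;
--  nonemptiness follows).
Countable : Set → Set
Countable A = A ↣ ℕ

Infinite : Set → Set
Infinite A = ℕ ↣ A

module Submission where

-- Suppose t ≼ u is derivable under every closed substitution.  Pick one
-- such substitution ρ that replaces each variable x by a fresh prefix
-- aₓ·0, where the actions aₓ are pairwise distinct and occur in neither
-- t nor u.  Then t ≼ u is recovered from ρ(t) ≼ ρ(u) by "collapsing":
-- the map on terms that turns every prefix aₓ·s back into x.  Collapsing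
-- sends every axiom instance to an axiom instance (or, for WIF1 at a
-- collapsed action, to an instance of A3), so it preserves derivability,
-- and it undoes ρ on t and u.

open import Defs
open import Data.Nat using (ℕ; zero; suc; _≤_; _<_; _+_; _⊔_; _≟_; _<?_; z≤n; s≤s)
open import Data.Nat.Properties
open import Data.Fin using (Fin; toℕ; fromℕ<)
open import Data.Fin.Properties using (toℕ<n; fromℕ<-injective; toℕ-injective; <⇒notInjective)
open import Data.Empty using (⊥-elim)
open import Data.Maybe using (Maybe; just; nothing)
open import Data.Product using (∃; _×_; _,_; proj₁; proj₂)
open import Data.Sum using (inj₁; inj₂)
open import Function.Definitions using (Injective)
open import Function.Bundles using (Injection)
open import Function.Construct.Composition using (_↣-∘_)
open import Relation.Binary.Definitions using (tri<; tri≈; tri>)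
open import Relation.Nullary using (yes; no; contradiction)
open import Relation.Binary.PropositionalEquality hiding ([_])

-- An injective function ℕ → ℕ takes values above every bound: otherwise
-- it would map the 2 + B numbers below 2 + B injectively into the
-- B + 1 numbers below B + 1.  The witness is found by bounded search.
injective-unbounded : (h : ℕ → ℕ) → Injective _≡_ _≡_ h → ∀ B → ∃ λ n → B < h n
injective-unbounded h h-inj B with anyUpTo? (λ n → B <? h n) (2 + B)
... | yes (n , _ , B<hn) = n , B<hn
... | no none = ⊥-elim (<⇒notInjective ≤-refl squeeze-injective)
  where
  squeeze : Fin (2 + B) → Fin (suc B)
  squeeze i = fromℕ< (s≤s (≮⇒≥ λ B<h → none (toℕ i , toℕ<n i , B<h)))

  squeeze-injective : Injective _≡_ _≡_ squeeze
  squeeze-injective eq = toℕ-injective (h-inj (fromℕ<-injective _ _ _ _ eq))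

maxCode : {A : Set} → (A → ℕ) → Term A → ℕ
maxCode code 𝟎 = 0
maxCode code (var _) = 0
maxCode code (τ · t) = maxCode code t
maxCode code (act a · t) = code a ⊔ maxCode code t
maxCode code (t ⊕ u) = maxCode code t ⊔ maxCode code u

module FreshNames {A : Set} (code : A → ℕ)
                  (unbounded : ∀ B → ∃ λ a → B < code a) (B : ℕ) where

  name : ℕ → A
  name zero = let a , _ = unbounded B in a
  name (suc x) = let a , _ = unbounded (code (name x)) in a

  level : ℕ → ℕ
  level x = code (name x)

  B<level : ∀ x → B < level x
  B<level zero = let _ , B<a = unbounded B in B<a
  B<level (suc x) = let _ , lx<a = unbounded (level x) in <-trans (B<level x) lx<a

  level-step : ∀ x → level x < level (suc x)
  level-step x = let _ , lx<a = unbounded (level x) in lx<a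

  level-increasing : ∀ {x y} → x < y → level x < level y
  level-increasing {x} {suc y} (s≤s x≤y) with m≤n⇒m<n∨m≡n x≤y
  ... | inj₁ x<y = <-trans (level-increasing x<y) (level-step y)
  ... | inj₂ refl = level-step y

  level-injective : ∀ {x y} → level x ≡ level y → x ≡ y
  level-injective {x} {y} eq with <-cmp x y
  ... | tri< x<y _ _ = contradiction eq (<⇒≢ (level-increasing x<y))
  ... | tri≈ _ x≡y _ = x≡y
  ... | tri> _ _ y<x = contradiction (sym eq) (<⇒≢ (level-increasing y<x))

  -- Strict increase makes level x ≥ x, so the index of a level k can be
  -- searched for below k + 1.
  x≤level : ∀ x → x ≤ level x
  x≤level zero = z≤n
  x≤level (suc x) = ≤-<-trans (x≤level x) (level-step x)

  decode : A → Maybe ℕ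
  decode a with anyUpTo? (λ x → level x ≟ code a) (suc (code a))
  ... | yes (x , _ , _) = just x
  ... | no _ = nothing

  decode-name : ∀ x → decode (name x) ≡ just x
  decode-name x with anyUpTo? (λ y → level y ≟ level x) (suc (level x))
  ... | yes (y , _ , ly≡lx) = cong just (level-injective ly≡lx)
  ... | no none = contradiction (x , s≤s (x≤level x) , refl) none

  decode-small : ∀ a → code a ≤ B → decode a ≡ nothing
  decode-small a a≤B with anyUpTo? (λ x → level x ≟ code a) (suc (code a))
  ... | yes (x , _ , lx≡a) = contradiction (≤-trans (≤-reflexive lx≡a) a≤B) (<⇒≱ (B<level x))
  ... | no _ = refl

module Collapse {A : Set} (decode : A → Maybe ℕ) where

  replace : Maybe ℕ → A → Term A → Term A
  replace (just x) _ _ = var x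
  replace nothing a s = act a · s

  prefix : Act A → Term A → Term A
  prefix τ s = τ · s
  prefix (act a) s = replace (decode a) a s

  collapse : Term A → Term A
  collapse 𝟎 = 𝟎
  collapse (var x) = var x
  collapse (α · s) = prefix α (collapse s)
  collapse (s ⊕ s′) = collapse s ⊕ collapse s′

  -- prefix α is monotone: a collapsed prefix ignores its argument.
  prefix-mono : ∀ α {s s′} → A ⊢ s ≼ s′ → A ⊢ prefix α s ≼ prefix α s′
  prefix-mono τ s≼s′ = ctx· s≼s′
  prefix-mono (act a) s≼s′ with decode a
  ... | just _ = refl≼
  ... | nothing = ctx· s≼s′

  -- WIF1 survives collapsing: at a collapsed action both of its sides
  -- become x and x + x, related by A3.
  prefix-wif1 : ∀ α {s s′} →
    (A ⊢ prefix α (τ · s ⊕ τ · s′) ≼ prefix α s ⊕ prefix α s′) ×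
    (A ⊢ prefix α s ⊕ prefix α s′ ≼ prefix α (τ · s ⊕ τ · s′))
  prefix-wif1 τ = wif1→ , wif1←
  prefix-wif1 (act a) with decode a
  ... | just _ = a3← , a3→
  ... | nothing = wif1→ , wif1←

  collapse-sound : ∀ {s s′} → A ⊢ s ≼ s′ → A ⊢ collapse s ≼ collapse s′
  collapse-sound refl≼ = refl≼
  collapse-sound (trans≼ p q) = trans≼ (collapse-sound p) (collapse-sound q)
  collapse-sound (ctx· {α} p) = prefix-mono α (collapse-sound p)
  collapse-sound (ctx⊕ p q) = ctx⊕ (collapse-sound p) (collapse-sound q)
  collapse-sound a1 = a1
  collapse-sound a2→ = a2→
  collapse-sound a2← = a2←
  collapse-sound a3→ = a3→
  collapse-sound a3← = a3←
  collapse-sound a4→ = a4→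
  collapse-sound a4← = a4←
  collapse-sound (wif1→ {α}) = proj₁ (prefix-wif1 α)
  collapse-sound (wif1← {α}) = proj₂ (prefix-wif1 α)
  collapse-sound wif2′ = wif2′
  collapse-sound w1 = w1

  collapse-undoes : (name : ℕ → A) → (∀ x → decode (name x) ≡ just x) →
    (code : A → ℕ) (B : ℕ) → (∀ a → code a ≤ B → decode a ≡ nothing) →
    (t : Term A) → maxCode code t ≤ B → collapse (t [ (λ x → act (name x) · 𝟎) ]) ≡ t
  collapse-undoes name decode-name code B small-kept = undo
    where
    undo : (t : Term A) → maxCode code t ≤ B → collapse (t [ (λ x → act (name x) · 𝟎) ]) ≡ t
    undo 𝟎 _ = refl
    undo (var x) _ rewrite decode-name x = refl
    undo (τ · s) s≤B = cong (τ ·_) (undo s s≤B)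
    undo (act a · s) as≤B
      rewrite small-kept a (m⊔n≤o⇒m≤o _ _ as≤B) = cong (act a ·_) (undo s (m⊔n≤o⇒n≤o _ _ as≤B))
    undo (s ⊕ s′) ss′≤B = cong₂ _⊕_ (undo s (m⊔n≤o⇒m≤o _ _ ss′≤B)) (undo s′ (m⊔n≤o⇒n≤o _ _ ss′≤B))

corollary6p3 : (A : Set) → Countable A → Infinite A → OmegaComplete A
corollary6p3 A countable infinite t u closedInstances =
  subst₂ (A ⊢_≼_) (undo t (m≤m⊔n _ _)) (undo u (m≤n⊔m (maxCode code t) _))
    (collapse-sound (closedInstances (λ x → act (name x) · 𝟎) (λ _ → c· c𝟎)))
  where
  code : A → ℕ
  code = Injection.to countable

  codes-unbounded : ∀ B → ∃ λ a → B < code a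
  codes-unbounded B =
    let n , B<n = injective-unbounded _ (Injection.injective (countable ↣-∘ infinite)) B
    in Injection.to infinite n , B<n

  B : ℕ
  B = maxCode code t ⊔ maxCode code u

  open FreshNames code codes-unbounded B
  open Collapse decode

  undo : (s : Term A) → maxCode code s ≤ B → collapse (s [ (λ x → act (name x) · 𝟎) ]) ≡ s
  undo = collapse-undoes name decode-name code B decode-small
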